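{- Let $\sigma$ be a weakly consecutive permutation of $[k]$, and let $p$ be a prime and $c\ge1$ an integer with $p^c\le k<p^c+p^{c-1}$. Then the permutation $S_{p,c}(\sigma)$ of $[k]$ defined by $S_{p,c}(\sigma)(i)=p^c$ if $\sigma(i)=p^{c-1}$, $S_{p,c}(\sigma)(i)=p^{c-1}$ if $\sigma(i)=p^c$, and $S_{p,c}(\sigma)(i)=\sigma(i)$ otherwise (i.e. the values $p^c$ and $p^{c-1}$ are swapped), is weakly consecutive.
   Context: $[k]=\{1,\dots,k\}$. A permutation $\sigma:[k]\to[k]$ is weakly consecutive if for all $i,j\in[k]$ and all integers $m$, whenever $m\mid\sigma(i)$ and $m\mid(i-j)$, also $m\mid\sigma(j)$. -}

module Defs where

open import Data.Nat using (ℕ; suc; _≟_)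
open import Data.Fin using (Fin; toℕ)
open import Data.Fin.Permutation using (Permutation′; _⟨$⟩ʳ_)
open import Data.Integer using (ℤ; +_; _-_)
open import Data.Integer.Divisibility using (_∣_)
open import Relation.Nullary.Decidable using (does)
open import Data.Bool using (if_then_else_)

-- [k] = {1,…,k} is represented by Fin k via  i ↦ toℕ i + 1.
-- A permutation of [k] is a bijection Fin k ↔ Fin k; its value at the
-- element (toℕ i + 1) of [k] is  toℕ (σ i) + 1.

⌜_⌝ : ∀ {k} → Fin k → ℤ
⌜ i ⌝ = + suc (toℕ i)

val : ∀ {k} → Permutation′ k → Fin k → ℕ
val σ i = suc (toℕ (σ ⟨$⟩ʳ i))

WeaklyConsecutiveMap : ∀ {k} → (Fin k → ℕ) → Set
WeaklyConsecutiveMap {k} f =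
  (i j : Fin k) (m : ℤ) → m ∣ (+ f i) → m ∣ (⌜ i ⌝ - ⌜ j ⌝) → m ∣ (+ f j)

WeaklyConsecutive : ∀ {k} → Permutation′ k → Set
WeaklyConsecutive σ = WeaklyConsecutiveMap (val σ)

swapVal : ℕ → ℕ → ℕ → ℕ
swapVal a b x =
  if does (x ≟ b) then a else (if does (x ≟ a) then b else x)

-- S_{p,c}(σ)(i) = p^c if σ(i) = p^{c-1}; p^{c-1} if σ(i) = p^c; σ(i) otherwise
-- (q = p^c, r = p^{c-1})
S : ∀ {k} → (q r : ℕ) → Permutation′ k → Fin k → ℕ
S q r σ i = swapVal q r (val σ i)

-- Only the values r = p^(c-1) and q = p^c move. A modulus n dividing both
-- or neither of them cannot tell q and r apart, so the swapped map inherits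
-- weak consecutiveness from σ. Otherwise n ∣ q but n ∤ r, hence q ∣ n.
-- Then q divides S(σ)(i) ≤ k < 2q, so S(σ)(i) = q and σ(i) = r; and if
-- i ≠ j then |i - j| ≥ q, so some position z carries a multiple of r while
-- z + q < k. But then the p + 1 positions z, z + r, …, z + p r carry
-- distinct positive multiples of r, and there are at most p of these up to
-- k < (p + 1) r.
module Submission where

open import Defs
open import Data.Nat using (ℕ; suc; _+_; _^_; _∸_; _≤_; _<_)
open import Data.Nat.Primality using (Prime)
open import Data.Fin.Permutation using (Permutation′)

open import Data.Bool using (true; false)
open import Data.Empty using (⊥)
open import Data.Fin using (Fin; toℕ; fromℕ<)
open import Data.Fin.Properties using (toℕ<n; toℕ-injective; toℕ-fromℕ<; pigeonhole)
open import Data.Fin.Permutation using (_⟨$⟩ʳ_)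
open import Data.Integer as ℤ using (+_)
import Data.Integer.Properties as ℤ
open import Data.Nat
  using (zero; _*_; pred; ∣_-_∣; _≡ᵇ_; z≤n; z<s; s≤s⁻¹;
         NonZero; >-nonZero; >-nonZero⁻¹; nonTrivial⇒n>1)
open import Data.Nat.Properties
open import Data.Nat.Divisibility
  using (_∣_; divides; _∣?_; ∣-trans; ∣-reflexive; ∣⇒≤; ∣1⇒≡1;
         *-cancelˡ-∣; *-monoˡ-∣; n∣m*n)
open import Data.Nat.Coprimality using (Coprime; coprime-divisor)
open import Data.Nat.Primality using (prime⇒irreducible; prime⇒nonZero; prime⇒nonTrivial)
open import Data.Product using (_×_; _,_; proj₁; proj₂)
open import Data.Sum using (_⊎_; inj₁; inj₂)
open import Function using (_∘_; const)
open import Function.Bundles using (_⇔_; mk⇔; Equivalence; Injection)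
open import Function.Definitions using (Injective)
open import Function.Properties.Inverse using (↔⇒↣)
import Function.Properties.Equivalence as ⇔
open import Relation.Binary using (tri<; tri≈; tri>)
open import Relation.Binary.PropositionalEquality
open import Relation.Nullary using (Dec; yes; no; contradiction)

∣p^[1+c]⇒∣p^c⊎p^[1+c]∣ : ∀ {p n} → Prime p → ∀ c →
  n ∣ p ^ suc c → n ∣ p ^ c ⊎ p ^ suc c ∣ n
∣p^[1+c]⇒∣p^c⊎p^[1+c]∣ {p} {n} pr c n∣p^[1+c] with p ∣? n
... | no p∤n = inj₁ (coprime-divisor n⊥p n∣p^[1+c])
  where
  n⊥p : Coprime n p
  n⊥p (d∣n , d∣p) with prime⇒irreducible pr d∣p
  ... | inj₁ d≡1 = d≡1
  ... | inj₂ refl = contradiction d∣n p∤n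
... | yes (divides t refl) = from-quotient c t∣p^c
  where
  instance _ = prime⇒nonZero pr
  t∣p^c : t ∣ p ^ c
  t∣p^c = *-cancelˡ-∣ p (subst (_∣ p ^ suc c) (*-comm t p) n∣p^[1+c])
  from-quotient : ∀ e → t ∣ p ^ e → t * p ∣ p ^ e ⊎ p ^ suc e ∣ t * p
  from-quotient zero    t∣1 rewrite ∣1⇒≡1 t∣1 = inj₂ (∣-reflexive (*-comm p 1))
  from-quotient (suc e) t∣p^[1+e] with ∣p^[1+c]⇒∣p^c⊎p^[1+c]∣ pr e t∣p^[1+e]
  ... | inj₁ t∣p^e =
    inj₁ (subst (t * p ∣_) (*-comm (p ^ e) p) (*-monoˡ-∣ p t∣p^e))
  ... | inj₂ p^[1+e]∣t =
    inj₂ (subst (_∣ t * p) (*-comm (p ^ suc e) p) (*-monoˡ-∣ p p^[1+e]∣t))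

m∣n∧n<m+m⇒n≡m : ∀ {m n} → m ∣ n → 0 < n → n < m + m → n ≡ m
m∣n∧n<m+m⇒n≡m {m} (divides 1 refl) _ _ = +-identityʳ m
m∣n∧n<m+m⇒n≡m {m} (divides (suc (suc t)) refl) _ n<m+m =
  contradiction (+-monoʳ-≤ m (m≤m+n m (t * m))) (<⇒≱ n<m+m)

o∣∣m-n∣⇒m+o≤n : ∀ {m n o} → m < n → o ∣ ∣ m - n ∣ → m + o ≤ n
o∣∣m-n∣⇒m+o≤n {m} {n} {o} m<n o∣∣m-n∣ = begin
  m + o       ≤⟨ +-monoʳ-≤ m (∣⇒≤ o∣n∸m) ⟩
  m + (n ∸ m) ≡⟨ m+[n∸m]≡n (<⇒≤ m<n) ⟩
  n           ∎
  where
  open ≤-Reasoning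
  instance _ = >-nonZero (m<n⇒0<n∸m m<n)
  o∣n∸m : o ∣ n ∸ m
  o∣n∸m = subst (o ∣_) (m≤n⇒∣m-n∣≡n∸m (<⇒≤ m<n)) o∣∣m-n∣

∣+m-+n∣≡∣m-n∣ : ∀ m n → ℤ.∣ + m ℤ.- + n ∣ ≡ ∣ m - n ∣
∣+m-+n∣≡∣m-n∣ m n with ≤-total m n
... | inj₁ m≤n = begin
  ℤ.∣ + m ℤ.- + n ∣ ≡⟨ cong ℤ.∣_∣ (ℤ.[+m]-[+n]≡m⊖n m n) ⟩
  ℤ.∣ m ℤ.⊖ n ∣     ≡⟨ ℤ.∣⊖∣-≤ m≤n ⟩
  n ∸ m             ≡⟨ m≤n⇒∣m-n∣≡n∸m m≤n ⟨
  ∣ m - n ∣         ∎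
  where open ≡-Reasoning
... | inj₂ n≤m = begin
  ℤ.∣ + m ℤ.- + n ∣ ≡⟨ ℤ.∣i-j∣≡∣j-i∣ (+ m) (+ n) ⟩
  ℤ.∣ + n ℤ.- + m ∣ ≡⟨ cong ℤ.∣_∣ (ℤ.[+m]-[+n]≡m⊖n n m) ⟩
  ℤ.∣ n ℤ.⊖ m ∣     ≡⟨ ℤ.∣⊖∣-≤ n≤m ⟩
  m ∸ n             ≡⟨ m≤n⇒∣n-m∣≡n∸m n≤m ⟨
  ∣ m - n ∣         ∎
  where open ≡-Reasoning

-- `does (x ≟ b)` computes to `x ≡ᵇ b`, so the case splits abstract over that
-- boolean together with its reflection lemmas.
swapVal-⇔ : ∀ (P : ℕ → Set) {a b} x → (P a ⇔ P b) → P x ⇔ P (swapVal a b x)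
swapVal-⇔ P {a} {b} x Pa⇔Pb with x ≡ᵇ b | ≡ᵇ⇒≡ x b
... | true  | x≡b rewrite x≡b _ = ⇔.sym Pa⇔Pb
... | false | _ with x ≡ᵇ a | ≡ᵇ⇒≡ x a
...   | true  | x≡a rewrite x≡a _ = Pa⇔Pb
...   | false | _ = ⇔.refl

swapVal≡a⇒≡b : ∀ {a b x} → a ≢ b → swapVal a b x ≡ a → x ≡ b
swapVal≡a⇒≡b {a} {b} {x} a≢b eq with x ≡ᵇ b | ≡ᵇ⇒≡ x b
... | true  | x≡b = x≡b _
... | false | _ with x ≡ᵇ a | ≡⇒≡ᵇ x a
...   | true  | _   = contradiction (sym eq) a≢b
...   | false | x≢a = contradiction eq x≢a

-- The quotient of v s by d lies in [1, t], so it is one of only t labels.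
pigeonhole-multiples : ∀ {t d} (v : Fin (suc t) → ℕ) → Injective _≡_ _≡_ v →
  (∀ s → d ∣ v s) → (∀ s → 0 < v s) → (∀ s → v s < suc t * d) → ⊥
pigeonhole-multiples {t} {d} v v-injective d∣v 0<v v<[1+t]d
  = let s , s′ , s<s′ , same-label = pigeonhole (n<1+n t) label
    in <-irrefl (cong toℕ (v-injective (v-equal same-label))) s<s′
  where
  quot : Fin (suc t) → ℕ
  quot s = _∣_.quotient (d∣v s)

  v≡quot*d : ∀ s → v s ≡ quot s * d
  v≡quot*d s = _∣_.equality (d∣v s)

  instance
    quot-nonZero : ∀ {s} → NonZero (quot s)
    quot-nonZero {s} = m*n≢0⇒m≢0 (quot s) {{subst NonZero (v≡quot*d s) (>-nonZero (0<v s))}}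

  pred-quot<t : ∀ s → pred (quot s) < t
  pred-quot<t s = subst (_≤ t) (sym (suc-pred (quot s))) (s≤s⁻¹ quot<1+t)
    where
    quot<1+t : quot s < suc t
    quot<1+t = *-cancelʳ-< d (quot s) (suc t) (subst (_< suc t * d) (v≡quot*d s) (v<[1+t]d s))

  label : Fin (suc t) → Fin t
  label s = fromℕ< (pred-quot<t s)

  v-equal : ∀ {s s′} → label s ≡ label s′ → v s ≡ v s′
  v-equal {s} {s′} eq = begin
    v s          ≡⟨ v≡quot*d s ⟩
    quot s * d   ≡⟨ cong (_* d) (pred-injective pred-quot≡) ⟩
    quot s′ * d  ≡⟨ v≡quot*d s′ ⟨
    v s′         ∎
    where
    open ≡-Reasoning
    pred-quot≡ : pred (quot s) ≡ pred (quot s′)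
    pred-quot≡ = trans (sym (toℕ-fromℕ< (pred-quot<t s)))
                       (trans (cong toℕ eq) (toℕ-fromℕ< (pred-quot<t s′)))

val-injective : ∀ {k} (σ : Permutation′ k) → Injective _≡_ _≡_ (val σ)
val-injective σ = Injection.injective (↔⇒↣ σ) ∘ toℕ-injective ∘ suc-injective

val≤k : ∀ {k} (σ : Permutation′ k) i → val σ i ≤ k
val≤k σ i = toℕ<n (σ ⟨$⟩ʳ i)

a∣swapVal-val⇒val≡b : ∀ {k} (σ : Permutation′ k) {a b} .{{_ : NonZero b}} i →
  b < a → a ≤ k → k < a + a → a ∣ swapVal a b (val σ i) → val σ i ≡ b
a∣swapVal-val⇒val≡b {k} σ {a} {b} i b<a a≤k k<a+a a∣swap =
  swapVal≡a⇒≡b (≢-sym (<⇒≢ b<a))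
    (m∣n∧n<m+m⇒n≡m a∣swap (proj₁ swap-bounded) (≤-<-trans (proj₂ swap-bounded) k<a+a))
  where
  instance _ = >-nonZero (≤-<-trans z≤n b<a)
  swap-bounded : 0 < swapVal a b (val σ i) × swapVal a b (val σ i) ≤ k
  swap-bounded = Equivalence.to (swapVal-⇔ (λ x → 0 < x × x ≤ k) (val σ i)
    (mk⇔ (const (>-nonZero⁻¹ b , ≤-trans (<⇒≤ b<a) a≤k)) (const (>-nonZero⁻¹ a , a≤k))))
    (z<s , val≤k σ i)

module _ {k} (σ : Permutation′ k) (wc : WeaklyConsecutive σ) where

  wc-ℕ : ∀ i j {n} → n ∣ val σ i → n ∣ ∣ toℕ i - toℕ j ∣ → n ∣ val σ j
  wc-ℕ i j {n} n∣σi n∣∣i-j∣ =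
    wc i j (+ n) n∣σi
      (subst (n ∣_) (sym (∣+m-+n∣≡∣m-n∣ (suc (toℕ i)) (suc (toℕ j)))) n∣∣i-j∣)

  -- Otherwise the positions z, z + d, …, z + t d would carry t + 1 distinct
  -- multiples of d in [1, k].
  ∣val⇒k≤i+t*d : ∀ {d t} .{{_ : NonZero d}} z →
    d ∣ val σ z → k < suc t * d → k ≤ toℕ z + t * d
  ∣val⇒k≤i+t*d {d} {t} z d∣σz k<[1+t]d = ≮⇒≥ λ z+td<k →
    pigeonhole-multiples (val σ ∘ position z+td<k) (v-injective z+td<k)
      (λ s → wc-ℕ z _ d∣σz (d∣∣z-position z+td<k s)) (λ _ → z<s)
      (λ s → ≤-<-trans (val≤k σ _) k<[1+t]d)
    where
    module _ (z+td<k : toℕ z + t * d < k) where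
      position : Fin (suc t) → Fin k
      position s = fromℕ<
        (≤-<-trans (+-monoʳ-≤ (toℕ z) (*-monoˡ-≤ d (s≤s⁻¹ (toℕ<n s)))) z+td<k)

      toℕ-position : ∀ s → toℕ (position s) ≡ toℕ z + toℕ s * d
      toℕ-position s = toℕ-fromℕ< _

      d∣∣z-position : ∀ s → d ∣ ∣ toℕ z - toℕ (position s) ∣
      d∣∣z-position s rewrite toℕ-position s | ∣m-m+n∣≡n (toℕ z) (toℕ s * d) =
        n∣m*n (toℕ s)

      v-injective : Injective _≡_ _≡_ (val σ ∘ position)
      v-injective {s} {s′} eq = toℕ-injective (*-cancelʳ-≡ (toℕ s) (toℕ s′) d
        (+-cancelˡ-≡ (toℕ z) _ _ (trans (sym (toℕ-position s))
          (trans (cong toℕ (val-injective σ eq)) (toℕ-position s′)))))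

  val≡d∧t*d∣∣x-y∣⇒x≡y : ∀ {d t} .{{_ : NonZero d}} x y →
    val σ x ≡ d → k < suc t * d → t * d ∣ ∣ toℕ x - toℕ y ∣ → x ≡ y
  val≡d∧t*d∣∣x-y∣⇒x≡y {d} {t} x y σx≡d k<[1+t]d td∣∣x-y∣
    with <-cmp (toℕ x) (toℕ y)
  ... | tri≈ _ x≡y _ = toℕ-injective x≡y
  ... | tri< x<y _ _ = contradiction (∣val⇒k≤i+t*d {t = t} x (∣-reflexive (sym σx≡d)) k<[1+t]d)
    (<⇒≱ (≤-<-trans (o∣∣m-n∣⇒m+o≤n x<y td∣∣x-y∣) (toℕ<n y)))
  ... | tri> _ _ y<x = contradiction (∣val⇒k≤i+t*d {t = t} y d∣σy k<[1+t]d)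
    (<⇒≱ (≤-<-trans (o∣∣m-n∣⇒m+o≤n y<x td∣∣y-x∣) (toℕ<n x)))
    where
    d∣σy : d ∣ val σ y
    d∣σy = wc-ℕ x y (∣-reflexive (sym σx≡d)) (∣-trans (n∣m*n t) td∣∣x-y∣)
    td∣∣y-x∣ : t * d ∣ ∣ toℕ y - toℕ x ∣
    td∣∣y-x∣ = subst (t * d ∣_) (∣-∣-comm (toℕ x) (toℕ y)) td∣∣x-y∣

  swapVal-transfer : ∀ {a b n} i j → (n ∣ a ⇔ n ∣ b) →
    n ∣ swapVal a b (val σ i) → n ∣ ∣ toℕ i - toℕ j ∣ → n ∣ swapVal a b (val σ j)
  swapVal-transfer {n = n} i j a⇔b n∣swap-i n∣∣i-j∣ =
    Equivalence.to (swapVal-⇔ (n ∣_) (val σ j) a⇔b)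
      (wc-ℕ i j (Equivalence.from (swapVal-⇔ (n ∣_) (val σ i) a⇔b) n∣swap-i) n∣∣i-j∣)

mainTheorem11 : (k : ℕ) (σ : Permutation′ k) (p c : ℕ) → Prime p → 1 ≤ c →
    p ^ c ≤ k → k < p ^ c + p ^ (c ∸ 1) →
    WeaklyConsecutive σ →
    WeaklyConsecutiveMap (S (p ^ c) (p ^ (c ∸ 1)) σ)
mainTheorem11 k σ p (suc c) pr _ q≤k k<q+r wc i j m n∣Si m∣i-j = by-cases (n ∣? q)
  where
  q r n : ℕ
  q = p ^ suc c
  r = p ^ c
  n = ℤ.∣ m ∣

  instance
    _ = prime⇒nonZero pr
    _ = m^n≢0 p c

  r<q : r < q
  r<q = subst (r <_) (*-comm r p) (m<m*n r p (nonTrivial⇒n>1 p {{prime⇒nonTrivial pr}}))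

  n∣∣i-j∣ : n ∣ ∣ toℕ i - toℕ j ∣
  n∣∣i-j∣ = subst (n ∣_) (∣+m-+n∣≡∣m-n∣ (suc (toℕ i)) (suc (toℕ j))) m∣i-j

  transfer : (n ∣ q ⇔ n ∣ r) → n ∣ S q r σ j
  transfer q⇔r = swapVal-transfer σ wc {q} {r} i j q⇔r n∣Si n∣∣i-j∣

  by-cases : Dec (n ∣ q) → n ∣ S q r σ j
  by-cases (no n∤q) =
    transfer (mk⇔ (λ n∣q → contradiction n∣q n∤q) (λ n∣r → ∣-trans n∣r (n∣m*n p)))
  by-cases (yes n∣q) with ∣p^[1+c]⇒∣p^c⊎p^[1+c]∣ pr c n∣q
  ... | inj₁ n∣r = transfer (mk⇔ (const n∣r) (const n∣q))
  ... | inj₂ q∣n = subst (λ x → n ∣ S q r σ x) i≡j n∣Si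
    where
    σi≡r : val σ i ≡ r
    σi≡r = a∣swapVal-val⇒val≡b σ i r<q q≤k
      (<-≤-trans k<q+r (+-monoʳ-≤ q (<⇒≤ r<q))) (∣-trans q∣n n∣Si)
    i≡j : i ≡ j
    i≡j = val≡d∧t*d∣∣x-y∣⇒x≡y σ wc {r} {p} i j σi≡r
      (subst (k <_) (+-comm q r) k<q+r) (∣-trans q∣n n∣∣i-j∣)
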